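{- Let $S=\langle a,b\rangle$ with $2\le a<b$ and $\gcd(a,b)=1$, and put $g=\frac{ab-a-b+1}{2}$. Then $r(S)$ equals one less than the number of integer points in the closed right triangle with vertices $(0,0)$, $(g/a,0)$, $(0,g/b)$.
   Context: $\langle a,b\rangle=\{xa+yb:x,y\in\mathbb{N}_0\}$; it has genus $\frac{ab-a-b+1}{2}$. For a numerical semigroup $S$ of genus $g$, the ordinarization number $r(S)$ is the number of iterations of $T\mapsto T\cup\{F(T)\}\setminus\{m(T)\}$ ($F$ = largest gap, $m$ = smallest nonzero element) needed to reach $\{0,g+1,g+2,\ldots\}$; it is known that $r(S)=\#(S\cap\{1,\ldots,g\})$. -}

module Defs where

open import Data.Nat using (ℕ; zero; suc; _+_; _*_; _∸_; _/_; _≡ᵇ_; _<ᵇ_; _≤ᵇ_)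
open import Data.Bool using (Bool; true; false; if_then_else_; not; _∨_)
open import Data.List using (List; []; _∷_; map; upTo; reverse; filter; length)
open import Data.Bool.ListAction using (any)
open import Data.Nat.ListAction using (sum)
open import Relation.Binary.PropositionalEquality using (_≡_)

NSet : Set
NSet = ℕ → Bool

-- Membership in the semigroup ⟨a,b⟩ = {x a + y b : x , y ∈ ℕ₀}
-- (if n = x a + y b with a,b ≥ 1 then x,y ≤ n, so the search is exhaustive).
gen2 : ℕ → ℕ → NSet
gen2 a b n = any (λ x → any (λ y → (x * a + y * b) ≡ᵇ n) (upTo (suc n))) (upTo (suc n))

genus2 : ℕ → ℕ → ℕ
genus2 a b = (a * b ∸ a ∸ b + 1) / 2

ordinary : ℕ → NSet
ordinary g x = (x ≡ᵇ 0) ∨ (g <ᵇ x)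

firstIn : NSet → List ℕ → ℕ → ℕ
firstIn T [] d = d
firstIn T (x ∷ xs) d = if T x then x else firstIn T xs d

mult : ℕ → NSet → ℕ
mult B T = firstIn T (map suc (upTo B)) B

frob : ℕ → NSet → ℕ
frob B T = firstIn (λ x → not (T x)) (reverse (upTo (suc B))) 0

-- ordinarization transform T ↦ T ∪ {F(T)} \ {m(T)}
-- (B is a search bound exceeding every F(T) and m(T) that occurs)
ordStep : ℕ → NSet → NSet
ordStep B T x = if x ≡ᵇ frob B T then true else (if x ≡ᵇ mult B T then false else T x)

ordIter : ℕ → ℕ → NSet → NSet
ordIter B zero T = T
ordIter B (suc k) T = ordStep B (ordIter B k T)

_≐_ : NSet → NSet → Set
T ≐ U = ∀ x → T x ≡ U x

-- number of integer points (x , y) in the closed triangle with vertices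
-- (0,0), (g/a,0), (0,g/b), i.e. x,y ≥ 0 and a x + b y ≤ g
-- (any such point has x,y ≤ g when a,b ≥ 1)
trianglePoints : ℕ → ℕ → ℕ → ℕ
trianglePoints a b g =
  sum (map (λ x → length (filter (λ y → (a * x + b * y) Data.Nat.≤? g) (upTo (suc g)))) (upTo (suc g)))

module Submission where

-- Let S = ⟨a,b⟩ and F = a b - a - b = 2 g - 1. As a is invertible modulo b, each n satisfies
-- n ≡ x a (mod b) for a unique x < b, and n ∈ S iff x a ≤ n; hence n ∈ S iff F - n ∉ S, so S has
-- g elements in [0, 2g), and as many elements in [1, g] as gaps in [g + 1, 2g]. An ordinarization
-- step trades the multiplicity m(T) ≤ g for the Frobenius number F(T) > g: it preserves this balance
-- and lowers #(T ∩ [1, g]) by one, and a balanced T is ordinary exactly when that count is 0.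
-- So r(S) = #(S ∩ [1, g]). Finally, representations below a b are unique, so the lattice points
-- with a x + b y ≤ g correspond to the elements of S ∩ [0, g], of which there are 1 + r(S).

open import Defs
open import Data.Bool using (Bool; true; false; not)
open import Data.Bool.ListAction using (any)
open import Data.Bool.Properties using (T-≡; not-injective)
open import Data.Empty using (⊥; ⊥-elim)
open import Data.List using ([]; _∷_; applyUpTo; downFrom; filter; length; map; upTo)
open import Data.List.Properties using (map-upTo; reverse-upTo)
open import Data.List.Relation.Unary.Any.Properties using (any⁺; any⁻; applyUpTo⁺; applyUpTo⁻)
open import Data.Nat
open import Data.Nat.Properties
open import Data.Nat.DivMod
open import Data.Nat.Divisibility using (_∣_; _∣0; ∣-refl; ∣m∣n⇒∣m+n; ∣m⇒∣m*n; ∣n⇒∣m*n; ∣1⇒≡1)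
open import Data.Nat.GCD using (gcd; gcd-GCD; gcd-greatest; GCD; module Bézout)
open import Data.Nat.ListAction using (sum)
open import Data.Nat.Tactic.RingSolver using (solve-∀)
open import Data.Product using (∃-syntax; _×_; _,_; proj₁; proj₂)
open import Data.Sum using (_⊎_; inj₁; inj₂; [_,_]′)
open import Function using (_∘_; id; case_of_; Equivalence)
open import Relation.Nullary using (¬_; yes; no; does)
open import Relation.Nullary.Decidable using (dec-true; dec-false)
open import Relation.Unary using (Pred; Decidable)
open import Relation.Binary.PropositionalEquality
open import Algebra.Properties.CommutativeSemigroup +-commutativeSemigroup
  using () renaming (interchange to +-interchange; xy∙z≈xz∙y to +-right-comm)
open import Algebra.Properties.CommutativeSemigroup *-commutativeSemigroup
  using () renaming (xy∙z≈xz∙y to *-right-comm)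

∑< : ℕ → (ℕ → ℕ) → ℕ
∑< zero    f = 0
∑< (suc n) f = ∑< n f + f n

syntax ∑< n (λ i → e) = ∑[ i < n ] e

iverson : Bool → ℕ
iverson true  = 1
iverson false = 0

count : ℕ → (ℕ → Bool) → ℕ
count n p = ∑[ i < n ] iverson (p i)

∑<-cong : ∀ n {f h : ℕ → ℕ} → (∀ {i} → i < n → f i ≡ h i) → ∑< n f ≡ ∑< n h
∑<-cong zero    eq = refl
∑<-cong (suc n) eq = cong₂ _+_ (∑<-cong n (eq ∘ m<n⇒m<1+n)) (eq ≤-refl)

∑<-zero : ∀ n {f : ℕ → ℕ} → (∀ {i} → i < n → f i ≡ 0) → ∑< n f ≡ 0
∑<-zero zero    eq = refl
∑<-zero (suc n) eq = cong₂ _+_ (∑<-zero n (eq ∘ m<n⇒m<1+n)) (eq ≤-refl)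

∑<-single : ∀ n {f : ℕ → ℕ} {j} → j < n → (∀ {i} → i < n → i ≢ j → f i ≡ 0) → ∑< n f ≡ f j
∑<-single (suc n) {f} {j} j<1+n vanish with j ≟ n
... | yes refl = cong (_+ f n) (∑<-zero n (λ i<n → vanish (m<n⇒m<1+n i<n) (<⇒≢ i<n)))
... | no j≢n = begin
  ∑< n f + f n ≡⟨ cong₂ _+_ (∑<-single n (≤∧≢⇒< (≤-pred j<1+n) j≢n) (vanish ∘ m<n⇒m<1+n))
                             (vanish ≤-refl (j≢n ∘ sym)) ⟩
  f j + 0      ≡⟨ +-identityʳ (f j) ⟩
  f j          ∎
  where open ≡-Reasoning

∑<-suc : ∀ n (f : ℕ → ℕ) → ∑< (suc n) f ≡ f 0 + ∑< n (f ∘ suc)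
∑<-suc zero    f = +-comm 0 (f 0)
∑<-suc (suc n) f rewrite ∑<-suc n f = +-assoc (f 0) _ _

∑<-+ : ∀ m n (f : ℕ → ℕ) → ∑< (m + n) f ≡ ∑< m f + ∑< n (λ i → f (m + i))
∑<-+ m zero    f rewrite +-identityʳ m = sym (+-identityʳ _)
∑<-+ m (suc n) f rewrite +-suc m n | ∑<-+ m n f = +-assoc (∑< m f) _ _

∑<-reverse : ∀ n (f : ℕ → ℕ) → ∑< n f ≡ ∑< n (λ i → f (n ∸ suc i))
∑<-reverse zero    f = refl
∑<-reverse (suc n) f rewrite ∑<-suc n (λ i → f (suc n ∸ suc i)) | sym (∑<-reverse n f) =
  +-comm (∑< n f) (f n)

∑<-distrib-+ : ∀ n (f h : ℕ → ℕ) → ∑[ i < n ] (f i + h i) ≡ ∑< n f + ∑< n h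
∑<-distrib-+ zero    f h = refl
∑<-distrib-+ (suc n) f h rewrite ∑<-distrib-+ n f h = +-interchange (∑< n f) (∑< n h) (f n) (h n)

∑<-swap : ∀ m n (f : ℕ → ℕ → ℕ) → ∑[ i < m ] ∑[ j < n ] f i j ≡ ∑[ j < n ] ∑[ i < m ] f i j
∑<-swap zero    n f = sym (∑<-zero n (λ _ → refl))
∑<-swap (suc m) n f rewrite ∑<-swap m n f = sym (∑<-distrib-+ n _ (f m))

∑<-const-1 : ∀ n → ∑[ i < n ] 1 ≡ n
∑<-const-1 zero    = refl
∑<-const-1 (suc n) = trans (+-comm _ 1) (cong suc (∑<-const-1 n))

∑<≡0⇒≡0 : ∀ n {f : ℕ → ℕ} → ∑< n f ≡ 0 → ∀ {i} → i < n → f i ≡ 0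
∑<≡0⇒≡0 (suc n) {f} sum≡0 {i} i<1+n with i ≟ n
... | yes refl = m+n≡0⇒n≡0 (∑< n f) sum≡0
... | no i≢n   = ∑<≡0⇒≡0 n (m+n≡0⇒m≡0 _ sum≡0) (≤∧≢⇒< (≤-pred i<1+n) i≢n)

∑<-exchange : ∀ n {f h : ℕ → ℕ} {j} → j < n → (∀ {i} → i < n → i ≢ j → f i ≡ h i) →
              ∑< n f + h j ≡ ∑< n h + f j
∑<-exchange (suc n) {f} {h} {j} j<1+n agree with j ≟ n
... | yes refl rewrite ∑<-cong n (λ i<n → agree (m<n⇒m<1+n i<n) (<⇒≢ i<n)) =
  +-right-comm (∑< n h) (f n) (h n)
... | no j≢n rewrite agree ≤-refl (j≢n ∘ sym) = begin
  ∑< n f + h n + h j ≡⟨ +-right-comm (∑< n f) (h n) (h j) ⟩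
  ∑< n f + h j + h n ≡⟨ cong (_+ h n) (∑<-exchange n (≤∧≢⇒< (≤-pred j<1+n) j≢n) (agree ∘ m<n⇒m<1+n)) ⟩
  ∑< n h + f j + h n ≡⟨ +-right-comm (∑< n h) (f j) (h n) ⟩
  ∑< n h + h n + f j ∎
  where open ≡-Reasoning

count≡0⇒false : ∀ n {p : ℕ → Bool} → count n p ≡ 0 → ∀ {i} → i < n → p i ≡ false
count≡0⇒false n {p} count≡0 {i} i<n with p i | ∑<≡0⇒≡0 n count≡0 i<n
... | false | _  = refl
... | true  | ()

count≢0⇒true : ∀ n {p : ℕ → Bool} → count n p ≢ 0 → ∃[ i ] i < n × p i ≡ true
count≢0⇒true zero    count≢0 = ⊥-elim (count≢0 refl)
count≢0⇒true (suc n) {p} count≢0 with p n in pn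
... | true  = n , ≤-refl , pn
... | false =
  let i , i<n , pi = count≢0⇒true n (count≢0 ∘ trans (+-identityʳ _)) in i , m<n⇒m<1+n i<n , pi

count-complement : ∀ n (p : ℕ → Bool) → count n p + count n (not ∘ p) ≡ n
count-complement n p = begin
  count n p + count n (not ∘ p)                      ≡⟨ ∑<-distrib-+ n _ _ ⟨
  ∑[ i < n ] (iverson (p i) + iverson (not (p i)))   ≡⟨ ∑<-cong n (λ {i} _ → one (p i)) ⟩
  ∑[ i < n ] 1                                       ≡⟨ ∑<-const-1 n ⟩
  n                                                  ∎
  where
  open ≡-Reasoning
  one : ∀ b → iverson b + iverson (not b) ≡ 1
  one true  = refl
  one false = refl

count-exchange : ∀ n (p q : ℕ → Bool) {j} → j < n → p j ≡ true → q j ≡ false →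
                 (∀ {i} → i < n → i ≢ j → p i ≡ q i) → count n p ≡ suc (count n q)
count-exchange n p q {j} j<n pj qj agree = begin
  count n p                   ≡⟨ +-identityʳ _ ⟨
  count n p + 0               ≡⟨ cong (λ b → count n p + iverson b) qj ⟨
  count n p + iverson (q j)   ≡⟨ ∑<-exchange n j<n (λ i<n i≢j → cong iverson (agree i<n i≢j)) ⟩
  count n q + iverson (p j)   ≡⟨ cong (λ b → count n q + iverson b) pj ⟩
  count n q + 1               ≡⟨ +-comm _ 1 ⟩
  suc (count n q)             ∎
  where open ≡-Reasoning

count-≡ᵇ : ∀ v n → count (suc n) (λ i → v ≡ᵇ i) ≡ iverson (does (v ≤? n))
count-≡ᵇ v n with v ≤? n
... | yes v≤n = begin
  count (suc n) (λ i → v ≡ᵇ i) ≡⟨ ∑<-single (suc n) (s≤s v≤n)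
                                    (λ _ i≢v → cong iverson (dec-false (v ≟ _) (i≢v ∘ sym))) ⟩
  iverson (v ≡ᵇ v)             ≡⟨ cong iverson (dec-true (v ≟ v) refl) ⟩
  1                            ≡⟨ cong iverson (dec-true (v ≤? n) v≤n) ⟨
  iverson (does (v ≤? n))      ∎
  where open ≡-Reasoning
... | no v≰n  = begin
  count (suc n) (λ i → v ≡ᵇ i) ≡⟨ ∑<-zero (suc n) (λ i<1+n → cong iverson
                                    (dec-false (v ≟ _) (λ { refl → v≰n (≤-pred i<1+n) }))) ⟩
  0                            ≡⟨ cong iverson (dec-false (v ≤? n) v≰n) ⟨
  iverson (does (v ≤? n))      ∎
  where open ≡-Reasoning

sum-map-applyUpTo : ∀ (f g : ℕ → ℕ) n → sum (map f (applyUpTo g n)) ≡ ∑[ i < n ] f (g i)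
sum-map-applyUpTo f g zero    = refl
sum-map-applyUpTo f g (suc n) =
  trans (cong (f (g 0) +_) (sum-map-applyUpTo f (g ∘ suc) n)) (sym (∑<-suc n (f ∘ g)))

length-filter : ∀ {ℓ} {P : Pred ℕ ℓ} (P? : Decidable P) xs →
                length (filter P? xs) ≡ sum (map (λ x → iverson (does (P? x))) xs)
length-filter P? []       = refl
length-filter P? (x ∷ xs) with does (P? x)
... | true  = cong suc (length-filter P? xs)
... | false = length-filter P? xs

length-filter-upTo : ∀ {ℓ} {P : Pred ℕ ℓ} (P? : Decidable P) n →
                     length (filter P? (upTo n)) ≡ count n (λ i → does (P? i))
length-filter-upTo P? n = trans (length-filter P? (upTo n)) (sum-map-applyUpTo _ id n)

firstIn-applyUpTo : ∀ (X : NSet) f n d {i} → i < n → X (f i) ≡ true →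
                    ∃[ j ] j ≤ i × X (f j) ≡ true × firstIn X (applyUpTo f n) d ≡ f j
firstIn-applyUpTo X f (suc n) d {i} i<1+n Xfi with X (f 0) in Xf0
... | true = 0 , z≤n , Xf0 , refl
... | false with i
...   | zero   = ⊥-elim (case trans (sym Xfi) Xf0 of λ ())
...   | suc i′ =
  let j , j≤i′ , Xfj , first≡ = firstIn-applyUpTo X (f ∘ suc) n d (≤-pred i<1+n) Xfi
  in suc j , s≤s j≤i′ , Xfj , first≡

firstIn-downFrom : ∀ (X : NSet) n d {i} → i < n → X i ≡ true →
                   ∃[ j ] i ≤ j × j < n × X j ≡ true × firstIn X (downFrom n) d ≡ j
firstIn-downFrom X (suc n) d {i} i<1+n Xi with X n in Xn
... | true = n , ≤-pred i<1+n , ≤-refl , Xn , refl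
... | false with i ≟ n
...   | yes refl = ⊥-elim (case trans (sym Xi) Xn of λ ())
...   | no i≢n   =
  let j , i≤j , j<n , Xj , first≡ = firstIn-downFrom X n d (≤∧≢⇒< (≤-pred i<1+n) i≢n) Xi
  in j , i≤j , m<n⇒m<1+n j<n , Xj , first≡

mult-spec : ∀ B (X : NSet) {i} → i < B → X (suc i) ≡ true →
            ∃[ j ] j ≤ i × X (suc j) ≡ true × mult B X ≡ suc j
mult-spec B X i<B Xi rewrite map-upTo suc B = firstIn-applyUpTo X suc B B i<B Xi

frob-spec : ∀ B (X : NSet) {x} → x ≤ B → X x ≡ false →
            ∃[ F ] x ≤ F × F ≤ B × X F ≡ false × frob B X ≡ F
frob-spec B X x≤B Xx rewrite reverse-upTo (suc B) =
  let F , x≤F , F<1+B , XF , first≡ = firstIn-downFrom (not ∘ X) (suc B) 0 (s≤s x≤B) (cong not Xx)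
  in F , x≤F , ≤-pred F<1+B , not-injective XF , first≡

module _ (B : ℕ) (X : NSet) {m F : ℕ}
         (mult≡m : mult B X ≡ m) (frob≡F : frob B X ≡ F) (m≢F : m ≢ F) where

  ordStep-mult : ordStep B X m ≡ false
  ordStep-mult rewrite frob≡F | mult≡m | dec-false (m ≟ F) m≢F | dec-true (m ≟ m) refl = refl

  ordStep-frob : ordStep B X F ≡ true
  ordStep-frob rewrite frob≡F | dec-true (F ≟ F) refl = refl

  ordStep-other : ∀ {x} → x ≢ m → x ≢ F → ordStep B X x ≡ X x
  ordStep-other {x} x≢m x≢F
    rewrite frob≡F | mult≡m | dec-false (x ≟ F) x≢F | dec-false (x ≟ m) x≢m = refl

2*n≡n+n : ∀ n → 2 * n ≡ n + n
2*n≡n+n n = cong (n +_) (+-identityʳ n)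

m+m≡n+n⇒m≡n : ∀ {m n} → m + m ≡ n + n → m ≡ n
m+m≡n+n⇒m≡n {m} {n} eq = trans (n≡⌊n+n/2⌋ m) (trans (cong ⌊_/2⌋ eq) (sym (n≡⌊n+n/2⌋ n)))

module Ordinarization (g : ℕ) where

  smallElements : NSet → ℕ
  smallElements X = count g (λ i → X (suc i))

  largeGaps : NSet → ℕ
  largeGaps X = count g (λ i → not (X (suc (g + i))))

  -- For X containing 0 and all of (2g, ∞), balance says exactly that X has g gaps;
  -- every numerical semigroup of genus g is balanced.
  record Balanced (X : NSet) : Set where
    field
      zero∈       : X 0 ≡ true
      above-2g∈   : ∀ {x} → 2 * g < x → X x ≡ true
      small≡large : smallElements X ≡ largeGaps X

  upper-half : ∀ {x} → g < x → x ≤ 2 * g → ∃[ p ] p < g × x ≡ suc (g + p)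
  upper-half {x} g<x x≤2g =
    x ∸ suc g , +-cancelˡ-< g _ g g+p<g+g , sym (m+[n∸m]≡n g<x)
    where
    g+p<g+g : g + (x ∸ suc g) < g + g
    g+p<g+g = subst₂ _≤_ (sym (m+[n∸m]≡n g<x)) (2*n≡n+n g) x≤2g

  balanced-from-genus : ∀ {X} → X 0 ≡ true → (∀ {x} → 2 * g < x → X x ≡ true) →
                        count (suc (g + g)) X ≡ suc g → Balanced X
  balanced-from-genus {X} zero∈ above∈ elements =
    record { zero∈ = zero∈ ; above-2g∈ = above∈ ; small≡large = +-cancelʳ-≡ _ _ _ small+upper≡g }
    where
    upperElements nonzeroElements : ℕ
    upperElements = count g (λ i → X (suc (g + i)))
    nonzeroElements = count (g + g) (X ∘ suc)
    small+upper≡g : smallElements X + upperElements ≡ largeGaps X + upperElements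
    small+upper≡g = suc-injective (begin
      suc (smallElements X + upperElements)   ≡⟨ cong suc (∑<-+ g g _) ⟨
      1 + nonzeroElements                     ≡⟨ cong (λ b → iverson b + nonzeroElements) zero∈ ⟨
      iverson (X 0) + nonzeroElements         ≡⟨ ∑<-suc (g + g) _ ⟨
      count (suc (g + g)) X                   ≡⟨ elements ⟩
      suc g                                   ≡⟨ cong suc (count-complement g _) ⟨
      suc (upperElements + largeGaps X)       ≡⟨ cong suc (+-comm upperElements _) ⟩
      suc (largeGaps X + upperElements)       ∎)
      where open ≡-Reasoning

  g≤2g : g ≤ 2 * g
  g≤2g = m≤m+n g (g + 0)

  1+g+p≤2g : ∀ {p} → p < g → suc (g + p) ≤ 2 * g
  1+g+p≤2g {p} p<g = subst (_≤ 2 * g) (+-suc g p) (+-monoʳ-≤ g (≤-trans p<g (m≤m+n g 0)))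

  balanced-exchange : ∀ {X Y : NSet} {j p} → j < g → p < g →
    X (suc j) ≡ true → Y (suc j) ≡ false → X (suc (g + p)) ≡ false → Y (suc (g + p)) ≡ true →
    (∀ {x} → x ≢ suc j → x ≢ suc (g + p) → Y x ≡ X x) →
    Balanced X → Balanced Y × smallElements X ≡ suc (smallElements Y)
  balanced-exchange {X} {Y} {j} {p} j<g p<g Xm Ym XF YF unchanged bal = Y-balanced , small-drop
    where
    open Balanced bal
    small-drop : smallElements X ≡ suc (smallElements Y)
    small-drop = count-exchange g (X ∘ suc) (Y ∘ suc) j<g Xm Ym λ {i} i<g i≢j →
      sym (unchanged (i≢j ∘ suc-injective) (<⇒≢ (<-≤-trans i<g (m≤m+n g p)) ∘ suc-injective))
    large-drop : largeGaps X ≡ suc (largeGaps Y)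
    large-drop = count-exchange g (λ i → not (X (suc (g + i)))) (λ i → not (Y (suc (g + i))))
      p<g (cong not XF) (cong not YF) λ {i} i<g i≢p →
      cong not (sym (unchanged (>⇒≢ (<-≤-trans j<g (m≤m+n g i)) ∘ suc-injective)
                               (i≢p ∘ +-cancelˡ-≡ g i p ∘ suc-injective)))
    Y-balanced : Balanced Y
    Y-balanced = record
      { zero∈       = trans (unchanged (λ ()) (λ ())) zero∈
      ; above-2g∈   = λ 2g<x → trans (unchanged (>⇒≢ (≤-<-trans (≤-trans j<g g≤2g) 2g<x))
                                                (>⇒≢ (≤-<-trans (1+g+p≤2g p<g) 2g<x)))
                                     (above-2g∈ 2g<x)
      ; small≡large = suc-injective (trans (sym small-drop) (trans small≡large large-drop))
      }

  ordStep-balanced : ∀ {X} → Balanced X → smallElements X ≢ 0 →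
    Balanced (ordStep (2 * g) X) × smallElements X ≡ suc (smallElements (ordStep (2 * g) X))
  ordStep-balanced {X} bal small≢0
    with i , i<g , Xi ← count≢0⇒true g small≢0
       | i′ , i′<g , gapXi′ ← count≢0⇒true g (small≢0 ∘ trans (Balanced.small≡large bal))
    with j , j≤i , Xj , mult≡ ← mult-spec (2 * g) X (≤-trans i<g g≤2g) Xi
       | F , g+i′<F , F≤2g , XF , frob≡ ← frob-spec (2 * g) X (1+g+p≤2g i′<g) (not-injective gapXi′)
    with p , p<g , refl ← upper-half (<-≤-trans (s≤s (m≤m+n g i′)) g+i′<F) F≤2g
    = balanced-exchange j<g p<g Xj (ordStep-mult B X mult≡ frob≡ m≢F)
                        XF (ordStep-frob B X mult≡ frob≡ m≢F)
                        (ordStep-other B X mult≡ frob≡ m≢F) bal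
    where
    B : ℕ
    B = 2 * g
    j<g : j < g
    j<g = <-≤-trans (s≤s j≤i) i<g
    m≢F : suc j ≢ suc (g + p)
    m≢F = <⇒≢ (s≤s (≤-trans j<g (m≤m+n g p)))

  ordIter-balanced : ∀ k {c X} → Balanced X → smallElements X ≡ k + c →
    Balanced (ordIter (2 * g) k X) × smallElements (ordIter (2 * g) k X) ≡ c
  ordIter-balanced zero    bal small≡c = bal , small≡c
  ordIter-balanced (suc k) {c} bal small≡1+k+c
    with bal′ , small≡1+c ← ordIter-balanced k bal (trans small≡1+k+c (sym (+-suc k c)))
    with bal″ , drop ← ordStep-balanced bal′ (1+n≢0 ∘ trans (sym small≡1+c))
    = bal″ , suc-injective (trans (sym drop) small≡1+c)

  balanced-ordinary : ∀ {X} → Balanced X → smallElements X ≡ 0 → X ≐ ordinary g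
  balanced-ordinary bal small≡0 zero = zero∈
    where open Balanced bal
  balanced-ordinary {X} bal small≡0 (suc x) with suc x ≤? g | 2 * g <? suc x
  ... | yes 1+x≤g | _ =
    trans (count≡0⇒false g small≡0 1+x≤g) (sym (dec-false (g <? suc x) (≤⇒≯ 1+x≤g)))
  ... | no 1+x≰g | yes 2g<1+x =
    trans (Balanced.above-2g∈ bal 2g<1+x) (sym (dec-true (g <? suc x) (≰⇒> 1+x≰g)))
  ... | no 1+x≰g | no 2g≮1+x
    with p , p<g , 1+x≡1+g+p ← upper-half (≰⇒> 1+x≰g) (≮⇒≥ 2g≮1+x) =
    trans (subst (λ y → X y ≡ true) (sym 1+x≡1+g+p) in-upper-half)
          (sym (dec-true (g <? suc x) (≰⇒> 1+x≰g)))
    where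
    in-upper-half : X (suc (g + p)) ≡ true
    in-upper-half = not-injective
      (count≡0⇒false g (trans (sym (Balanced.small≡large bal)) small≡0) p<g)

  smallElements-cong : ∀ {X Y} → X ≐ Y → smallElements X ≡ smallElements Y
  smallElements-cong X≐Y = ∑<-cong g (λ {i} _ → cong iverson (X≐Y (suc i)))

  smallElements-ordinary : smallElements (ordinary g) ≡ 0
  smallElements-ordinary = ∑<-zero g (λ {i} i<g → cong iverson (dec-false (g <? suc i) (≤⇒≯ i<g)))

  ordinarization : ∀ {X} → Balanced X →
    ordIter (2 * g) (smallElements X) X ≐ ordinary g ×
    (∀ k → k < smallElements X → ¬ (ordIter (2 * g) k X ≐ ordinary g))
  ordinarization {X} bal = reaches-ordinary , not-earlier
    where
    reaches-ordinary : ordIter (2 * g) (smallElements X) X ≐ ordinary g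
    reaches-ordinary =
      let bal′ , small≡0 = ordIter-balanced (smallElements X) bal (sym (+-identityʳ _))
      in balanced-ordinary bal′ small≡0
    not-earlier : ∀ k → k < smallElements X → ¬ (ordIter (2 * g) k X ≐ ordinary g)
    not-earlier k k<c ordinary-at-k =
      let _ , small≡1+c′ = ordIter-balanced k bal (trans (sym (m+[n∸m]≡n k<c)) (sym (+-suc k _)))
      in 1+n≢0 (trans (sym small≡1+c′)
                      (trans (smallElements-cong ordinary-at-k) smallElements-ordinary))

modular-inverse : ∀ a b .{{_ : NonZero b}} → gcd a b ≡ 1 → ∃[ u ] (a * u) % b ≡ 1 % b
modular-inverse a b@(suc b′) gcd≡1 with Bézout.identity (subst (GCD a b) gcd≡1 (gcd-GCD a b))
... | Bézout.+- x y 1+yb≡xa = x , (begin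
  (a * x) % b       ≡⟨ cong (_% b) (trans (*-comm a x) (sym 1+yb≡xa)) ⟩
  (1 + y * b) % b   ≡⟨ [m+kn]%n≡m%n 1 y b ⟩
  1 % b             ∎)
  where open ≡-Reasoning
... | Bézout.-+ x y 1+xa≡yb = b′ * x , (begin
  (a * (b′ * x)) % b                 ≡⟨ [m+kn]%n≡m%n (a * (b′ * x)) y b ⟨
  (a * (b′ * x) + y * b) % b         ≡⟨ cong (λ t → (a * (b′ * x) + t) % b) 1+xa≡yb ⟨
  (a * (b′ * x) + (1 + x * a)) % b   ≡⟨ cong (_% b) (multiple-of-b a x b′) ⟩
  (1 + (x * a) * b) % b              ≡⟨ [m+kn]%n≡m%n 1 (x * a) b ⟩
  1 % b                              ∎)
  where
  open ≡-Reasoning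
  multiple-of-b : ∀ a x b′ → a * (b′ * x) + (1 + x * a) ≡ 1 + (x * a) * suc b′
  multiple-of-b = solve-∀

module TwoGenerated (a b : ℕ) .{{_ : NonZero a}} .{{_ : NonZero b}} (coprime : gcd a b ≡ 1) where

  infix 4 _≈_
  _≈_ : ℕ → ℕ → Set
  m ≈ n = m % b ≡ n % b

  ≈-*ʳ : ∀ {m n} k → m ≈ n → m * k ≈ n * k
  ≈-*ʳ {m} {n} k m≈n = begin
    (m * k) % b             ≡⟨ %-distribˡ-* m k b ⟩
    (m % b * (k % b)) % b   ≡⟨ cong (λ r → (r * (k % b)) % b) m≈n ⟩
    (n % b * (k % b)) % b   ≡⟨ %-distribˡ-* n k b ⟨
    (n * k) % b             ∎
    where open ≡-Reasoning

  ≈-*ˡ : ∀ k {m n} → m ≈ n → k * m ≈ k * n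
  ≈-*ˡ k {m} {n} m≈n = subst₂ _≈_ (*-comm m k) (*-comm n k) (≈-*ʳ k m≈n)

  ≈-+*b : ∀ m k → m + k * b ≈ m
  ≈-+*b m k = [m+kn]%n≡m%n m k b

  ≈-≤⇒+*b : ∀ {m n} → m ≈ n → m ≤ n → ∃[ k ] n ≡ m + k * b
  ≈-≤⇒+*b {m} {n} m≈n m≤n = k , (begin
    n                             ≡⟨ m≡m%n+[m/n]*n n b ⟩
    n % b + n / b * b             ≡⟨ cong₂ (λ r q → r + q * b) (sym m≈n)
                                              (sym (m+[n∸m]≡n (/-monoˡ-≤ b m≤n))) ⟩
    m % b + (m / b + k) * b       ≡⟨ cong (m % b +_) (*-distribʳ-+ b (m / b) k) ⟩
    m % b + (m / b * b + k * b)   ≡⟨ +-assoc (m % b) _ _ ⟨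
    m % b + m / b * b + k * b     ≡⟨ cong (_+ k * b) (m≡m%n+[m/n]*n m b) ⟨
    m + k * b                     ∎)
    where
    open ≡-Reasoning
    k : ℕ
    k = n / b ∸ m / b

  a⁻¹ : ℕ
  a⁻¹ = proj₁ (modular-inverse a b coprime)

  *a*a⁻¹≈ : ∀ x → x * a * a⁻¹ ≈ x
  *a*a⁻¹≈ x = begin
    (x * a * a⁻¹) % b     ≡⟨ cong (_% b) (*-assoc x a a⁻¹) ⟩
    (x * (a * a⁻¹)) % b   ≡⟨ ≈-*ˡ x (proj₂ (modular-inverse a b coprime)) ⟩
    (x * 1) % b           ≡⟨ cong (_% b) (*-identityʳ x) ⟩
    x % b                 ∎
    where open ≡-Reasoning

  *a-injective : ∀ {x y} → x < b → y < b → x * a ≈ y * a → x ≡ y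
  *a-injective {x} {y} x<b y<b xa≈ya = begin
    x                   ≡⟨ m<n⇒m%n≡m x<b ⟨
    x % b               ≡⟨ *a*a⁻¹≈ x ⟨
    (x * a * a⁻¹) % b   ≡⟨ ≈-*ʳ a⁻¹ xa≈ya ⟩
    (y * a * a⁻¹) % b   ≡⟨ *a*a⁻¹≈ y ⟩
    y % b               ≡⟨ m<n⇒m%n≡m y<b ⟩
    y                   ∎
    where open ≡-Reasoning

  -- The unique x < b with x * a ≡ n (mod b); n ∈ ⟨a,b⟩ exactly when x * a ≤ n.
  residue : ℕ → ℕ
  residue n = (n * a⁻¹) % b

  residue<b : ∀ n → residue n < b
  residue<b n = m%n<n (n * a⁻¹) b

  residue-≈ : ∀ n → residue n * a ≈ n
  residue-≈ n = begin
    (residue n * a) % b   ≡⟨ ≈-*ʳ a (m%n%n≡m%n (n * a⁻¹) b) ⟩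
    (n * a⁻¹ * a) % b     ≡⟨ cong (_% b) (*-right-comm n a⁻¹ a) ⟩
    (n * a * a⁻¹) % b     ≡⟨ *a*a⁻¹≈ n ⟩
    n % b                 ∎
    where open ≡-Reasoning

  Representable : ℕ → Set
  Representable n = ∃[ x ] ∃[ y ] x * a + y * b ≡ n

  residue-representable : ∀ n → residue n * a ≤ n → Representable n
  residue-representable n ra≤n = let k , n≡ = ≈-≤⇒+*b (residue-≈ n) ra≤n in residue n , k , sym n≡

  residue-overshoot : ∀ n → n < residue n * a → ∃[ k ] residue n * a ≡ n + suc k * b
  residue-overshoot n n<ra with ≈-≤⇒+*b (sym (residue-≈ n)) (<⇒≤ n<ra)
  ... | zero  , ra≡n+0 = ⊥-elim (<⇒≢ n<ra (sym (trans ra≡n+0 (+-identityʳ n))))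
  ... | suc k , ra≡    = k , ra≡

  representable-above : ∀ n → a * b < n + a + b → Representable n
  representable-above n ab<n+a+b with residue n * a ≤? n
  ... | yes ra≤n = residue-representable n ra≤n
  ... | no  ra≰n with k , ra≡ ← residue-overshoot n (≰⇒> ra≰n) =
    ⊥-elim (<-irrefl refl (<-≤-trans ab<n+a+b n+a+b≤ab))
    where
    open ≤-Reasoning
    n+a+b≤ab : n + a + b ≤ a * b
    n+a+b≤ab = begin
      n + a + b              ≡⟨ +-right-comm n a b ⟩
      n + b + a              ≤⟨ +-monoˡ-≤ a (+-monoʳ-≤ n (m≤m+n b (k * b))) ⟩
      n + suc k * b + a      ≡⟨ cong (_+ a) ra≡ ⟨
      residue n * a + a      ≡⟨ +-comm _ a ⟩
      suc (residue n) * a    ≤⟨ *-monoˡ-≤ a (residue<b n) ⟩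
      b * a                  ≡⟨ *-comm b a ⟩
      a * b                  ∎

  -- x and z are mirror images under n ↦ F - n, F = a b - a - b the Frobenius number.
  representable-either : ∀ x z → x + z + a + b ≡ a * b → Representable x ⊎ Representable z
  representable-either x z mirror with residue x * a ≤? x
  ... | yes ra≤x = inj₁ (residue-representable x ra≤x)
  ... | no  ra≰x with k , ra≡ ← residue-overshoot x (≰⇒> ra≰x) =
    inj₂ (t , k , +-cancelʳ-≡ (x + a + b) _ z (begin
      t * a + k * b + (x + a + b)    ≡⟨ regroup t a k b x ⟩
      t * a + a + (x + suc k * b)    ≡⟨ cong (t * a + a +_) ra≡ ⟨
      t * a + a + residue x * a      ≡⟨ collect t a (residue x) ⟩
      (suc (residue x) + t) * a      ≡⟨ cong (_* a) (m+[n∸m]≡n (residue<b x)) ⟩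
      b * a                          ≡⟨ *-comm b a ⟩
      a * b                          ≡⟨ mirror ⟨
      x + z + a + b                  ≡⟨ to-front x z a b ⟩
      z + (x + a + b)                ∎))
    where
    open ≡-Reasoning
    t : ℕ
    t = b ∸ suc (residue x)
    regroup : ∀ t a k b x → t * a + k * b + (x + a + b) ≡ t * a + a + (x + (b + k * b))
    regroup = solve-∀
    collect : ∀ t a r → t * a + a + r * a ≡ (suc r + t) * a
    collect = solve-∀
    to-front : ∀ x z a b → x + z + a + b ≡ z + (x + a + b)
    to-front = solve-∀

  *a<ab⇒<b : ∀ {x} → x * a < a * b → x < b
  *a<ab⇒<b {x} xa<ab = *-cancelʳ-< a x b (subst (x * a <_) (*-comm a b) xa<ab)

  representable-not-both : ∀ x z → x + z + a + b ≡ a * b →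
                           Representable x → Representable z → ⊥
  representable-not-both x z mirror (x₁ , y₁ , x≡) (x₂ , y₂ , z≡) = 1+n≢0 X≡0
    where
    X Y : ℕ
    X = suc (x₁ + x₂)
    Y = suc (y₁ + y₂)
    Xa+Yb≡ab : X * a + Y * b ≡ a * b
    Xa+Yb≡ab = trans (sum-of-reps x₁ x₂ y₁ y₂ a b) (trans (cong₂ (λ p q → p + q + a + b) x≡ z≡) mirror)
      where
      sum-of-reps : ∀ x₁ x₂ y₁ y₂ a b →
        suc (x₁ + x₂) * a + suc (y₁ + y₂) * b ≡ (x₁ * a + y₁ * b) + (x₂ * a + y₂ * b) + a + b
      sum-of-reps = solve-∀
    X<b : X < b
    X<b = *a<ab⇒<b (<-≤-trans (m<m+n (X * a) (<-≤-trans (>-nonZero⁻¹ b) (m≤m+n b _)))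
                              (≤-reflexive Xa+Yb≡ab))
    Xa≈0 : X * a ≈ 0 * a
    Xa≈0 = begin
      (X * a) % b           ≡⟨ ≈-+*b (X * a) Y ⟨
      (X * a + Y * b) % b   ≡⟨ cong (_% b) Xa+Yb≡ab ⟩
      (a * b) % b           ≡⟨ m*n%n≡0 a b ⟩
      0                     ≡⟨ m*n%n≡0 0 b ⟨
      0 % b                 ∎
      where open ≡-Reasoning
    X≡0 : X ≡ 0
    X≡0 = *a-injective X<b (<-≤-trans (s≤s z≤n) X<b) Xa≈0

  representation-unique : ∀ {x y x′ y′} → x * a + y * b ≡ x′ * a + y′ * b → x * a + y * b < a * b →
                          x ≡ x′ × y ≡ y′
  representation-unique {x} {y} {x′} {y′} same below-ab = x≡x′ , y≡y′
    where
    x≡x′ : x ≡ x′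
    x≡x′ = *a-injective (*a<ab⇒<b (≤-<-trans (m≤m+n (x * a) (y * b)) below-ab))
                        (*a<ab⇒<b (≤-<-trans (m≤m+n (x′ * a) (y′ * b)) (subst (_< a * b) same below-ab)))
                        (trans (sym (≈-+*b (x * a) y)) (trans (cong (_% b) same) (≈-+*b (x′ * a) y′)))
    y≡y′ : y ≡ y′
    y≡y′ = *-cancelʳ-≡ y y′ b (+-cancelˡ-≡ (x * a) (y * b) (y′ * b)
             (trans same (cong (λ t → t * a + y′ * b) (sym x≡x′))))

  ax+by≡xa+yb : ∀ x y → a * x + b * y ≡ x * a + y * b
  ax+by≡xa+yb x y = cong₂ _+_ (*-comm a x) (*-comm b y)

  coefficients≤ : ∀ {x y n} → x * a + y * b ≡ n → x ≤ n × y ≤ n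
  coefficients≤ {x} {y} refl = ≤-trans (m≤m*n x a) (m≤m+n (x * a) (y * b))
                             , ≤-trans (m≤m*n y b) (m≤n+m (y * b) (x * a))

  gen2-sound : ∀ {n} → gen2 a b n ≡ true → Representable n
  gen2-sound {n} gen2≡true
    with x , _ , row ← applyUpTo⁻ id (any⁻ _ (upTo (suc n)) (Equivalence.from T-≡ gen2≡true))
    with y , _ , entry ← applyUpTo⁻ id (any⁻ _ (upTo (suc n)) row)
    = x , y , ≡ᵇ⇒≡ _ n entry

  gen2-complete : ∀ {n} → Representable n → gen2 a b n ≡ true
  gen2-complete {n} (x , y , rep) = Equivalence.to T-≡
    (any⁺ row (applyUpTo⁺ id {i = x} (any⁺ (entry x) (applyUpTo⁺ id {i = y} (≡⇒≡ᵇ _ n rep) (s≤s y≤n)))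
                                     (s≤s x≤n)))
    where
    entry : ℕ → ℕ → Bool
    entry x y = x * a + y * b ≡ᵇ n
    row : ℕ → Bool
    row x = any (entry x) (upTo (suc n))
    x≤n : x ≤ n
    x≤n = proj₁ (coefficients≤ {x} {y} rep)
    y≤n : y ≤ n
    y≤n = proj₂ (coefficients≤ {x} {y} rep)

  gen2-false : ∀ {n} → ¬ Representable n → gen2 a b n ≡ false
  gen2-false {n} ¬rep with gen2 a b n in gen2≡
  ... | true  = ⊥-elim (¬rep (gen2-sound gen2≡))
  ... | false = refl

  gen2-mirror : ∀ x z → x + z + a + b ≡ a * b → gen2 a b z ≡ not (gen2 a b x)
  gen2-mirror x z mirror with gen2 a b x in gen2≡
  ... | true  = gen2-false (representable-not-both x z mirror (gen2-sound gen2≡))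
  ... | false with representable-either x z mirror
  ...   | inj₁ rep-x = ⊥-elim (case trans (sym (gen2-complete rep-x)) gen2≡ of λ ())
  ...   | inj₂ rep-z = gen2-complete rep-z

  representation-count : ∀ {G n} → n ≤ G → n < a * b →
    ∑[ x < suc G ] ∑[ y < suc G ] iverson (a * x + b * y ≡ᵇ n) ≡ iverson (gen2 a b n)
  representation-count {G} {n} n≤G n<ab with gen2 a b n in gen2≡
  ... | false = ∑<-zero (suc G) λ {x} _ → ∑<-zero (suc G) λ {y} _ → cong iverson (dec-false (_ ≟ n)
      λ rep → case trans (sym (gen2-complete (x , y , trans (sym (ax+by≡xa+yb x y)) rep))) gen2≡ of λ ())
  ... | true with x₀ , y₀ , rep₀ ← gen2-sound gen2≡ = begin
    ∑[ x < suc G ] ∑[ y < suc G ] iverson (a * x + b * y ≡ᵇ n)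
      ≡⟨ ∑<-single (suc G) (s≤s (≤-trans (proj₁ (coefficients≤ {x₀} {y₀} rep₀)) n≤G)) other-row ⟩
    ∑[ y < suc G ] iverson (a * x₀ + b * y ≡ᵇ n)
      ≡⟨ ∑<-single (suc G) (s≤s (≤-trans (proj₂ (coefficients≤ {x₀} {y₀} rep₀)) n≤G)) other-column ⟩
    iverson (a * x₀ + b * y₀ ≡ᵇ n)
      ≡⟨ cong iverson (dec-true (_ ≟ n) (trans (ax+by≡xa+yb x₀ y₀) rep₀)) ⟩
    1 ∎
    where
    open ≡-Reasoning
    unique : ∀ {x y} → a * x + b * y ≡ n → x ≡ x₀ × y ≡ y₀
    unique {x} {y} rep = representation-unique (trans rep′ (sym rep₀)) (subst (_< a * b) (sym rep′) n<ab)
      where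
      rep′ : x * a + y * b ≡ n
      rep′ = trans (sym (ax+by≡xa+yb x y)) rep
    other-row : ∀ {x} → x < suc G → x ≢ x₀ → ∑[ y < suc G ] iverson (a * x + b * y ≡ᵇ n) ≡ 0
    other-row _ x≢x₀ = ∑<-zero (suc G) λ _ → cong iverson (dec-false (_ ≟ n) (x≢x₀ ∘ proj₁ ∘ unique))
    other-column : ∀ {y} → y < suc G → y ≢ y₀ → iverson (a * x₀ + b * y ≡ᵇ n) ≡ 0
    other-column _ y≢y₀ = cong iverson (dec-false (_ ≟ n) (y≢y₀ ∘ proj₂ ∘ unique))

  trianglePoints-count : ∀ G → G < a * b → trianglePoints a b G ≡ count (suc G) (gen2 a b)
  trianglePoints-count G G<ab = begin
    trianglePoints a b G
      ≡⟨ sum-map-applyUpTo _ id (suc G) ⟩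
    ∑[ x < suc G ] length (filter (λ y → a * x + b * y ≤? G) (upTo (suc G)))
      ≡⟨ ∑<-cong (suc G) (λ {x} _ → length-filter-upTo (λ y → a * x + b * y ≤? G) (suc G)) ⟩
    ∑[ x < suc G ] count (suc G) (λ y → does (a * x + b * y ≤? G))
      ≡⟨ ∑<-cong (suc G) (λ {x} _ → ∑<-cong (suc G) (λ {y} _ → count-≡ᵇ (a * x + b * y) G)) ⟨
    ∑[ x < suc G ] ∑[ y < suc G ] count (suc G) (λ n → a * x + b * y ≡ᵇ n)
      ≡⟨ ∑<-cong (suc G) (λ _ → ∑<-swap (suc G) (suc G) _) ⟩
    ∑[ x < suc G ] ∑[ n < suc G ] ∑[ y < suc G ] iverson (a * x + b * y ≡ᵇ n)
      ≡⟨ ∑<-swap (suc G) (suc G) _ ⟩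
    ∑[ n < suc G ] ∑[ x < suc G ] ∑[ y < suc G ] iverson (a * x + b * y ≡ᵇ n)
      ≡⟨ ∑<-cong (suc G) (λ n<1+G → representation-count (≤-pred n<1+G)
                                                          (≤-<-trans (≤-pred n<1+G) G<ab)) ⟩
    count (suc G) (gen2 a b) ∎
    where open ≡-Reasoning

module _ (a b g : ℕ) .{{_ : NonZero a}} .{{_ : NonZero b}} (coprime : gcd a b ≡ 1)
         (genus : g + g + a + b ≡ suc (a * b)) where

  open TwoGenerated a b coprime
  open Ordinarization g

  gen2-count-below-2g : count (g + g) (gen2 a b) ≡ g
  gen2-count-below-2g = m+m≡n+n⇒m≡n (begin
    count (g + g) (gen2 a b) + count (g + g) (gen2 a b)
      ≡⟨ cong (count (g + g) (gen2 a b) +_) (trans (∑<-reverse (g + g) _) (∑<-cong (g + g) mirror)) ⟩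
    count (g + g) (gen2 a b) + count (g + g) (not ∘ gen2 a b)
      ≡⟨ count-complement (g + g) (gen2 a b) ⟩
    g + g ∎)
    where
    open ≡-Reasoning
    mirror : ∀ {i} → i < g + g → iverson (gen2 a b (g + g ∸ suc i)) ≡ iverson (not (gen2 a b i))
    mirror {i} i<2g = cong iverson (gen2-mirror i _
      (suc-injective (trans (cong (λ t → t + a + b) (m+[n∸m]≡n i<2g)) genus)))

  gen2-balanced : Balanced (gen2 a b)
  gen2-balanced = balanced-from-genus refl above-2g elements
    where
    ab<2g+a+b : a * b < g + g + a + b
    ab<2g+a+b = ≤-reflexive (sym genus)
    above-2g : ∀ {x} → 2 * g < x → gen2 a b x ≡ true
    above-2g {x} 2g<x = gen2-complete (representable-above x (<-trans ab<2g+a+b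
      (+-monoˡ-< b (+-monoˡ-< a (subst (_< x) (2*n≡n+n g) 2g<x)))))
    elements : count (suc (g + g)) (gen2 a b) ≡ suc g
    elements = trans (cong₂ _+_ gen2-count-below-2g
                       (cong iverson (gen2-complete (representable-above (g + g) ab<2g+a+b))))
                     (+-comm g 1)

  trianglePoints-genus : trianglePoints a b g ≡ suc (smallElements (gen2 a b))
  trianglePoints-genus = trans (trianglePoints-count g g<ab) (∑<-suc g _)
    where
    g<ab : g < a * b
    g<ab = ≤-pred (begin
      suc (suc g)    ≡⟨ cong suc (+-comm 1 g) ⟩
      suc (g + 1)    ≡⟨ +-comm 1 (g + 1) ⟩
      g + 1 + 1      ≤⟨ +-mono-≤ (+-mono-≤ (m≤m+n g g) (>-nonZero⁻¹ a)) (>-nonZero⁻¹ b) ⟩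
      g + g + a + b  ≡⟨ genus ⟩
      suc (a * b)    ∎)
      where open ≤-Reasoning

  ordinarization-number :
    ordIter (2 * g) (trianglePoints a b g ∸ 1) (gen2 a b) ≐ ordinary g
    × (∀ k → k < trianglePoints a b g ∸ 1 → ¬ (ordIter (2 * g) k (gen2 a b) ≐ ordinary g))
  ordinarization-number rewrite trianglePoints-genus = ordinarization gen2-balanced

even-or-odd : ∀ n → 2 ∣ n ⊎ 2 ∣ suc n
even-or-odd zero    = inj₁ (2 ∣0)
even-or-odd (suc n) = [ inj₂ ∘ ∣m∣n⇒∣m+n ∣-refl , inj₁ ]′ (even-or-odd n)

coprime⇒2∣pred*pred : ∀ m n → gcd (suc m) (suc n) ≡ 1 → 2 ∣ m * n
coprime⇒2∣pred*pred m n coprime with even-or-odd m | even-or-odd n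
... | inj₁ 2∣m   | _          = ∣m⇒∣m*n n 2∣m
... | inj₂ _     | inj₁ 2∣n   = ∣n⇒∣m*n m 2∣n
... | inj₂ 2∣1+m | inj₂ 2∣1+n =
  ⊥-elim (case ∣1⇒≡1 (subst (2 ∣_) coprime (gcd-greatest 2∣1+m 2∣1+n)) of λ ())

-- That is, 2 g = (a - 1)(b - 1); the division in genus2 is exact as a and b are not both even.
genus2-spec : ∀ {a b} → 2 ≤ a → 2 ≤ b → gcd a b ≡ 1 → genus2 a b + genus2 a b + a + b ≡ suc (a * b)
genus2-spec {a@(suc (suc a₂))} {b@(suc (suc b₂))} (s≤s (s≤s z≤n)) (s≤s (s≤s z≤n)) coprime = begin
  genus2 a b + genus2 a b + a + b   ≡⟨ cong (λ t → t + a + b) g+g≡ ⟩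
  suc a₂ * suc b₂ + a + b           ≡⟨ close-up a₂ b₂ ⟩
  suc (a * b)                       ∎
  where
  open ≡-Reasoning
  P : ℕ
  P = a₂ * suc b₂ + b₂
  expand : ∀ a₂ b₂ → suc (suc a₂) * suc (suc b₂) ≡ a₂ * suc b₂ + b₂ + suc (suc b₂) + suc (suc a₂)
  expand = solve-∀
  collapse : ∀ a₂ b₂ → a₂ * suc b₂ + b₂ + 1 ≡ suc a₂ * suc b₂
  collapse = solve-∀
  close-up : ∀ a₂ b₂ →
    suc a₂ * suc b₂ + suc (suc a₂) + suc (suc b₂) ≡ suc (suc (suc a₂) * suc (suc b₂))
  close-up = solve-∀
  numerator : a * b ∸ a ∸ b + 1 ≡ suc a₂ * suc b₂
  numerator = begin
    a * b ∸ a ∸ b + 1       ≡⟨ cong (λ t → t ∸ a ∸ b + 1) (expand a₂ b₂) ⟩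
    P + b + a ∸ a ∸ b + 1   ≡⟨ cong (λ t → t ∸ b + 1) (m+n∸n≡m (P + b) a) ⟩
    P + b ∸ b + 1           ≡⟨ cong (_+ 1) (m+n∸n≡m P b) ⟩
    P + 1                   ≡⟨ collapse a₂ b₂ ⟩
    suc a₂ * suc b₂         ∎
  2∣numerator : 2 ∣ suc a₂ * suc b₂
  2∣numerator = coprime⇒2∣pred*pred (suc a₂) (suc b₂) coprime
  g+g≡ : genus2 a b + genus2 a b ≡ suc a₂ * suc b₂
  g+g≡ = begin
    genus2 a b + genus2 a b                   ≡⟨ cong (λ n → n / 2 + n / 2) numerator ⟩
    suc a₂ * suc b₂ / 2 + suc a₂ * suc b₂ / 2 ≡⟨ 2*n≡n+n (suc a₂ * suc b₂ / 2) ⟨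
    2 * (suc a₂ * suc b₂ / 2)                 ≡⟨ m*[n/m]≡n 2∣numerator ⟩
    suc a₂ * suc b₂                           ∎

mainTheorem14 : (a b : ℕ) → 2 ≤ a → a < b → gcd a b ≡ 1 →
    (ordIter (2 * genus2 a b) (trianglePoints a b (genus2 a b) ∸ 1) (gen2 a b) ≐ ordinary (genus2 a b))
    × (∀ k → k < trianglePoints a b (genus2 a b) ∸ 1 →
         ¬ (ordIter (2 * genus2 a b) k (gen2 a b) ≐ ordinary (genus2 a b)))
mainTheorem14 a b 2≤a a<b coprime = ordinarization-number a b (genus2 a b) coprime genus
  where
  2≤b : 2 ≤ b
  2≤b = ≤-trans 2≤a (<⇒≤ a<b)
  instance
    a≢0 : NonZero a
    a≢0 = >-nonZero (≤-trans (s≤s z≤n) 2≤a)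
    b≢0 : NonZero b
    b≢0 = >-nonZero (≤-trans (s≤s z≤n) 2≤b)
  genus : genus2 a b + genus2 a b + a + b ≡ suc (a * b)
  genus = genus2-spec 2≤a 2≤b coprime
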